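{- Let $p\geq 2$ be an integer, let $\alpha$ be a constant with $0<\alpha<1$, let $G$ be a $p$-claw free graph with minimum degree $\delta_G$, let $D$ be a minimum-cardinality $\alpha$-dominating set of $G$, and let $I$ be any maximal independent set of $G$. Then $|D|\geq \min\left\{\frac{\lceil \alpha\delta_G\rceil}{p-1},1\right\}\cdot|I|$.
   Context: All graphs are finite, simple, undirected and have no isolated vertices. A graph is $p$-claw free if it has no induced subgraph isomorphic to $K_{1,p}$. A set $D\subseteq V(G)$ is an $\alpha$-dominating set if every vertex $v\notin D$ has at least $\alpha\cdot d_v$ neighbors in $D$, where $d_v$ is the degree of $v$.
   Formalization: The constant α ranges over the rationals strictly between 0 and 1 instead of over the reals. -}

module Defs where

open import Data.Bool using (Bool; true; false; T)
open import Data.Nat as ℕ using (ℕ; suc)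
open import Data.Integer as ℤ using (ℤ; +_)
open import Data.Rational as ℚ using (ℚ; _/_; _≤_; _<_; _*_; _⊓_; 0ℚ; 1ℚ; ceiling)
open import Data.Fin using (Fin)
open import Data.Fin.Subset using (Subset; _∈_; _∉_; ∣_∣; _∩_; ⁅_⁆)
open import Data.Vec using (tabulate)
open import Data.Product using (Σ; ∃; _×_; _,_)
open import Function.Definitions using (Injective)
open import Relation.Binary.PropositionalEquality using (_≡_)
open import Relation.Nullary using (¬_)
open import Data.Fin.Subset using (Side; inside; outside)

record Graph (n : ℕ) : Set where
  field
    adj     : Fin n → Fin n → Bool
    sym     : ∀ u v → adj u v ≡ adj v u
    irrefl  : ∀ v → adj v v ≡ false

open Graph public

Adj : ∀ {n} → Graph n → Fin n → Fin n → Set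
Adj G u v = T (adj G u v)

toSide : Bool → Side
toSide true  = inside
toSide false = outside

N : ∀ {n} → Graph n → Fin n → Subset n
N G v = tabulate (λ u → toSide (adj G v u))

deg : ∀ {n} → Graph n → Fin n → ℕ
deg G v = ∣ N G v ∣

NoIsolated : ∀ {n} → Graph n → Set
NoIsolated G = ∀ v → 1 ℕ.≤ deg G v

IsMinDegree : ∀ {n} → Graph n → ℕ → Set
IsMinDegree G δ = (∀ v → δ ℕ.≤ deg G v) × (∃ λ v → deg G v ≡ δ)

HasInducedClaw : ∀ {n} → ℕ → Graph n → Set
HasInducedClaw {n} p G =
  Σ (Fin n) λ c → Σ (Fin p → Fin n) λ f →
    Injective _≡_ _≡_ f × (∀ i → Adj G c (f i)) ×
    (∀ i j → ¬ (i ≡ j) → ¬ Adj G (f i) (f j))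

ClawFree : ∀ {n} → ℕ → Graph n → Set
ClawFree p G = ¬ HasInducedClaw p G

toℚ : ℕ → ℚ
toℚ k = (+ k) / 1

IsAlphaDominating : ∀ {n} → Graph n → ℚ → Subset n → Set
IsAlphaDominating G α D =
  ∀ v → v ∉ D → α * toℚ (deg G v) ≤ toℚ ∣ N G v ∩ D ∣

IsMinAlphaDominating : ∀ {n} → Graph n → ℚ → Subset n → Set
IsMinAlphaDominating G α D =
  IsAlphaDominating G α D × (∀ D′ → IsAlphaDominating G α D′ → ∣ D ∣ ℕ.≤ ∣ D′ ∣)

IsIndependent : ∀ {n} → Graph n → Subset n → Set
IsIndependent G I = ∀ u v → u ∈ I → v ∈ I → ¬ Adj G u v

IsMaximalIndependent : ∀ {n} → Graph n → Subset n → Set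
IsMaximalIndependent G I =
  IsIndependent G I × (∀ v → v ∉ I → ¬ IsIndependent G (I Data.Fin.Subset.∪ ⁅ v ⁆))

-- z / d as a rational; the case d = 0 is a junk value (never used when d ≥ 1).
_/ℕ_ : ℤ → ℕ → ℚ
z /ℕ 0       = 0ℚ
z /ℕ (suc d) = z / suc d

module Submission where

-- Split I into I ∩ D and I ─ D, and D into I ∩ D and D ─ I. A vertex of I ─ D lies outside D, so it
-- has at least ⌈αδ⌉ neighbours in D, and all of them lie in D ─ I because I is independent. A vertex
-- has fewer than p neighbours in the independent set I, as they would be the leaves of a claw.
-- Counting the edges between I ─ D and D ─ I gives ⌈αδ⌉ ∣I ─ D∣ ≤ (p − 1) ∣D ─ I∣, hence
-- min(⌈αδ⌉/(p − 1), 1) ∣I∣ ≤ ∣I ∩ D∣ + ∣D ─ I∣ = ∣D∣.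

open import Defs hiding (sym)
import Data.Nat.Properties as ℕₚ
open import Relation.Binary.PropositionalEquality

module Counting where

  open import Algebra.Properties.CommutativeSemigroup ℕₚ.+-commutativeSemigroup using (interchange)
  open import Data.Bool using (true; T)
  open import Data.Fin using (Fin; zero; suc)
  import Data.Fin.Properties as Finₚ
  open import Data.Fin.Subset using (Subset; Side; inside; outside; _∈_; _∉_; _⊆_; ∣_∣; _∩_; _─_)
  open import Data.Fin.Subset.Properties using (p⊆q⇒∣p∣≤∣q∣; x∈p∩q⁺; x∈p∩q⁻; p─q⊆p; x∈p∧x∉q⇒x∈p─q)
  open import Data.Nat using (ℕ; zero; suc; _+_; _*_; _≤_; _<_; _<?_; z≤n; s≤s)
  open import Data.Product using (Σ; _×_; _,_; proj₁; proj₂)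
  open import Data.Unit using (tt)
  open import Data.Vec using ([]; _∷_; here; there; tabulate)
  open import Data.Vec.Properties using ([]=⇒lookup; lookup∘tabulate)
  open import Function using (_∘_)
  open import Function.Definitions using (Injective)
  open import Relation.Nullary using (¬_; yes; no; contradiction)

  ∑∈ : ∀ {n} → Subset n → (Fin n → ℕ) → ℕ
  ∑∈ []            f = 0
  ∑∈ (inside  ∷ p) f = f zero + ∑∈ p (f ∘ suc)
  ∑∈ (outside ∷ p) f = ∑∈ p (f ∘ suc)

  ∑∈-const : ∀ {n} (p : Subset n) k → ∑∈ p (λ _ → k) ≡ k * ∣ p ∣
  ∑∈-const []            k = sym (ℕₚ.*-zeroʳ k)
  ∑∈-const (inside  ∷ p) k = trans (cong (k +_) (∑∈-const p k)) (sym (ℕₚ.*-suc k ∣ p ∣))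
  ∑∈-const (outside ∷ p) k = ∑∈-const p k

  ∑∈-mono : ∀ {n} (p : Subset n) {f g : Fin n → ℕ} → (∀ {i} → i ∈ p → f i ≤ g i) → ∑∈ p f ≤ ∑∈ p g
  ∑∈-mono []            f≤g = z≤n
  ∑∈-mono (inside  ∷ p) f≤g = ℕₚ.+-mono-≤ (f≤g here) (∑∈-mono p (f≤g ∘ there))
  ∑∈-mono (outside ∷ p) f≤g = ∑∈-mono p (f≤g ∘ there)

  ∑∈-cong : ∀ {n} (p : Subset n) {f g : Fin n → ℕ} → (∀ i → f i ≡ g i) → ∑∈ p f ≡ ∑∈ p g
  ∑∈-cong []            f≗g = refl
  ∑∈-cong (inside  ∷ p) f≗g = cong₂ _+_ (f≗g zero) (∑∈-cong p (f≗g ∘ suc))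
  ∑∈-cong (outside ∷ p) f≗g = ∑∈-cong p (f≗g ∘ suc)

  ∑∈-distrib-+ : ∀ {n} (p : Subset n) (f g : Fin n → ℕ) → ∑∈ p (λ i → f i + g i) ≡ ∑∈ p f + ∑∈ p g
  ∑∈-distrib-+ []            f g = refl
  ∑∈-distrib-+ (inside  ∷ p) f g =
    trans (cong (f zero + g zero +_) (∑∈-distrib-+ p (f ∘ suc) (g ∘ suc)))
          (interchange (f zero) (g zero) (∑∈ p (f ∘ suc)) (∑∈ p (g ∘ suc)))
  ∑∈-distrib-+ (outside ∷ p) f g = ∑∈-distrib-+ p (f ∘ suc) (g ∘ suc)

  ∑∈-comm : ∀ {m n} (p : Subset m) (q : Subset n) (f : Fin m → Fin n → ℕ) →
            ∑∈ p (λ i → ∑∈ q (f i)) ≡ ∑∈ q (λ j → ∑∈ p (λ i → f i j))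
  ∑∈-comm []            q f = sym (∑∈-const q 0)
  ∑∈-comm (inside  ∷ p) q f =
    trans (cong (∑∈ q (f zero) +_) (∑∈-comm p q (f ∘ suc)))
          (sym (∑∈-distrib-+ q (f zero) (λ j → ∑∈ p (λ i → f (suc i) j))))
  ∑∈-comm (outside ∷ p) q f = ∑∈-comm p q (f ∘ suc)

  𝟙 : Side → ℕ
  𝟙 inside  = 1
  𝟙 outside = 0

  ∣tabulate∩∣ : ∀ {n} (s : Fin n → Side) (p : Subset n) → ∣ tabulate s ∩ p ∣ ≡ ∑∈ p (𝟙 ∘ s)
  ∣tabulate∩∣ s []            = refl
  ∣tabulate∩∣ s (inside  ∷ p) with s zero
  ... | inside  = cong suc (∣tabulate∩∣ (s ∘ suc) p)
  ... | outside = ∣tabulate∩∣ (s ∘ suc) p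
  ∣tabulate∩∣ s (outside ∷ p) with s zero
  ... | inside  = ∣tabulate∩∣ (s ∘ suc) p
  ... | outside = ∣tabulate∩∣ (s ∘ suc) p

  x∈p─q⇒x∉q : ∀ {n} {x : Fin n} (p q : Subset n) → x ∈ p ─ q → x ∉ q
  x∈p─q⇒x∉q (_ ∷ p) (outside ∷ q) (there x∈p─q) (there x∈q) = x∈p─q⇒x∉q p q x∈p─q x∈q
  x∈p─q⇒x∉q (_ ∷ p) (inside  ∷ q) (there x∈p─q) (there x∈q) = x∈p─q⇒x∉q p q x∈p─q x∈q

  ∣p∣≡∣p∩q∣+∣p─q∣ : ∀ {n} (p q : Subset n) → ∣ p ∣ ≡ ∣ p ∩ q ∣ + ∣ p ─ q ∣
  ∣p∣≡∣p∩q∣+∣p─q∣ []            []            = refl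
  ∣p∣≡∣p∩q∣+∣p─q∣ (inside  ∷ p) (inside  ∷ q) = cong suc (∣p∣≡∣p∩q∣+∣p─q∣ p q)
  ∣p∣≡∣p∩q∣+∣p─q∣ (inside  ∷ p) (outside ∷ q) =
    trans (cong suc (∣p∣≡∣p∩q∣+∣p─q∣ p q)) (sym (ℕₚ.+-suc ∣ p ∩ q ∣ ∣ p ─ q ∣))
  ∣p∣≡∣p∩q∣+∣p─q∣ (outside ∷ p) (inside  ∷ q) = ∣p∣≡∣p∩q∣+∣p─q∣ p q
  ∣p∣≡∣p∩q∣+∣p─q∣ (outside ∷ p) (outside ∷ q) = ∣p∣≡∣p∩q∣+∣p─q∣ p q

  k≤∣p∣⇒injection : ∀ {n k} (p : Subset n) → k ≤ ∣ p ∣ →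
                    Σ (Fin k → Fin n) λ f → Injective _≡_ _≡_ f × (∀ i → f i ∈ p)
  k≤∣p∣⇒injection {k = zero} p _ = (λ ()) , (λ { {()} }) , (λ ())
  k≤∣p∣⇒injection {k = suc k} (inside ∷ p) (s≤s k≤∣p∣) = f , f-inj , f∈p
    where
    g : Σ (Fin k → Fin _) λ g → Injective _≡_ _≡_ g × (∀ i → g i ∈ p)
    g = k≤∣p∣⇒injection p k≤∣p∣
    f : Fin (suc k) → Fin _
    f zero    = zero
    f (suc i) = suc (proj₁ g i)
    f-inj : Injective _≡_ _≡_ f
    f-inj {zero}  {zero}  _   = refl
    f-inj {suc i} {suc j} eq = cong suc (proj₁ (proj₂ g) (Finₚ.suc-injective eq))
    f∈p : ∀ i → f i ∈ inside ∷ p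
    f∈p zero    = here
    f∈p (suc i) = there (proj₂ (proj₂ g) i)
  k≤∣p∣⇒injection {k = suc k} (outside ∷ p) k≤∣p∣ =
    let f , f-inj , f∈p = k≤∣p∣⇒injection p k≤∣p∣
    in  suc ∘ f , f-inj ∘ Finₚ.suc-injective , there ∘ f∈p

  toSide≡inside⇒T : ∀ {b} → toSide b ≡ inside → T b
  toSide≡inside⇒T {true} _ = tt

  ∈N⇒Adj : ∀ {n} (G : Graph n) {u v} → v ∈ N G u → Adj G u v
  ∈N⇒Adj G {u} {v} v∈N = toSide≡inside⇒T (trans (sym (lookup∘tabulate _ v)) ([]=⇒lookup v∈N))

  ClawFree⇒∣N∩I∣<p : ∀ {n p} (G : Graph n) → ClawFree p G → (I : Subset n) → IsIndependent G I →
                     ∀ u → ∣ N G u ∩ I ∣ < p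
  ClawFree⇒∣N∩I∣<p {p = p} G claw-free I indep u with ∣ N G u ∩ I ∣ <? p
  ... | yes bound = bound
  ... | no ¬bound with k≤∣p∣⇒injection (N G u ∩ I) (ℕₚ.≮⇒≥ ¬bound)
  ...   | f , f-inj , f∈N∩I = contradiction (u , f , (λ {i j} → f-inj {i} {j}) , centre~leaf , leaves≁) claw-free
    where
    leaf : ∀ i → f i ∈ N G u × f i ∈ I
    leaf i = x∈p∩q⁻ (N G u) I (f∈N∩I i)
    centre~leaf : ∀ i → Adj G u (f i)
    centre~leaf i = ∈N⇒Adj G (proj₁ (leaf i))
    leaves≁ : ∀ i j → ¬ i ≡ j → ¬ Adj G (f i) (f j)
    leaves≁ i j _ = indep (f i) (f j) (proj₂ (leaf i)) (proj₂ (leaf j))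

  double-counting : ∀ {n} (G : Graph n) (p q : Subset n) {k m : ℕ} →
                    (∀ {v} → v ∈ p → k ≤ ∣ N G v ∩ q ∣) → (∀ {u} → u ∈ q → ∣ N G u ∩ p ∣ ≤ m) →
                    k * ∣ p ∣ ≤ m * ∣ q ∣
  double-counting G p q {k} {m} p-degree q-degree = begin
    k * ∣ p ∣                            ≡⟨ ∑∈-const p k ⟨
    ∑∈ p (λ _ → k)                       ≤⟨ ∑∈-mono p p-degree ⟩
    ∑∈ p (λ v → ∣ N G v ∩ q ∣)           ≡⟨ ∑∈-cong p (λ v → ∣tabulate∩∣ _ q) ⟩
    ∑∈ p (λ v → ∑∈ q (λ u → edge v u))   ≡⟨ ∑∈-comm p q edge ⟩
    ∑∈ q (λ u → ∑∈ p (λ v → edge v u))   ≡⟨ ∑∈-cong q (λ u → ∑∈-cong p (λ v → edge-sym v u)) ⟩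
    ∑∈ q (λ u → ∑∈ p (λ v → edge u v))   ≡⟨ ∑∈-cong q (λ u → ∣tabulate∩∣ _ p) ⟨
    ∑∈ q (λ u → ∣ N G u ∩ p ∣)           ≤⟨ ∑∈-mono q q-degree ⟩
    ∑∈ q (λ _ → m)                       ≡⟨ ∑∈-const q m ⟩
    m * ∣ q ∣                            ∎
    where
    open ℕₚ.≤-Reasoning
    edge : Fin _ → Fin _ → ℕ
    edge v u = 𝟙 (toSide (adj G v u))
    edge-sym : ∀ v u → edge v u ≡ edge u v
    edge-sym v u = cong (𝟙 ∘ toSide) (Graph.sym G v u)

  k*∣I─D∣≤m*∣D─I∣ : ∀ {n m k} (G : Graph n) → ClawFree (suc m) G → (I D : Subset n) → IsIndependent G I →
                    (∀ v → v ∉ D → k ≤ ∣ N G v ∩ D ∣) → k * ∣ I ─ D ∣ ≤ m * ∣ D ─ I ∣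
  k*∣I─D∣≤m*∣D─I∣ {m = m} {k} G claw-free I D indep D-degree = double-counting G (I ─ D) (D ─ I) I─D-degree D─I-degree
    where
    I─D-degree : ∀ {v} → v ∈ I ─ D → k ≤ ∣ N G v ∩ (D ─ I) ∣
    I─D-degree {v} v∈I─D = ℕₚ.≤-trans (D-degree v (x∈p─q⇒x∉q I D v∈I─D)) (p⊆q⇒∣p∣≤∣q∣ N∩D⊆N∩[D─I])
      where
      N∩D⊆N∩[D─I] : N G v ∩ D ⊆ N G v ∩ (D ─ I)
      N∩D⊆N∩[D─I] {x} x∈N∩D with x∈p∩q⁻ (N G v) D x∈N∩D
      ... | x∈N , x∈D = x∈p∩q⁺ (x∈N , x∈p∧x∉q⇒x∈p─q x∈D x∉I)
        where
        x∉I : x ∉ I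
        x∉I x∈I = indep v x (p─q⊆p I D v∈I─D) x∈I (∈N⇒Adj G x∈N)
    D─I-degree : ∀ {u} → u ∈ D ─ I → ∣ N G u ∩ (I ─ D) ∣ ≤ m
    D─I-degree {u} _ = ℕₚ.≤-trans (p⊆q⇒∣p∣≤∣q∣ N∩[I─D]⊆N∩I) (ℕₚ.≤-pred (ClawFree⇒∣N∩I∣<p G claw-free I indep u))
      where
      N∩[I─D]⊆N∩I : N G u ∩ (I ─ D) ⊆ N G u ∩ I
      N∩[I─D]⊆N∩I x∈ with x∈p∩q⁻ (N G u) (I ─ D) x∈
      ... | x∈N , x∈I─D = x∈p∩q⁺ (x∈N , p─q⊆p I D x∈I─D)

open import Data.Fin.Subset using (Subset; _∉_; ∣_∣; _∩_; _─_)
open import Data.Fin.Subset.Properties using (∩-comm)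
open import Data.Integer as ℤ using (ℤ; +_; -[1+_])
import Data.Integer.DivMod as ℤ
import Data.Integer.Properties as ℤₚ
open import Data.Nat as ℕ using (ℕ; suc; _≥_)
open import Data.Product using (_,_)
open import Data.Rational as ℚ
  using (ℚ; mkℚ; _/_; _≤_; _<_; _+_; _*_; _⊓_; 0ℚ; 1ℚ; floor; ceiling; toℚᵘ; NonNegative)
import Data.Rational.Properties as ℚₚ
open import Data.Rational.Unnormalised as ℚᵘ using (mkℚᵘ; *≤*; *≡*)
import Data.Rational.Unnormalised.Properties as ℚᵘₚ

open Counting

toℚᵘ-/ : ∀ a d → toℚᵘ ((+ a) / suc d) ℚᵘ.≃ mkℚᵘ (+ a) d
toℚᵘ-/ a d = ℚₚ.toℚᵘ-fromℚᵘ (mkℚᵘ (+ a) d)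

toℚ-nonNeg : ∀ a → NonNegative (toℚ a)
toℚ-nonNeg a = ℚₚ.normalize-nonNeg a 1

toℚ-+ : ∀ a b → toℚ (a ℕ.+ b) ≡ toℚ a + toℚ b
toℚ-+ a b = ℚₚ.toℚᵘ-injective (begin
  toℚᵘ (toℚ (a ℕ.+ b))              ≈⟨ toℚᵘ-/ (a ℕ.+ b) 0 ⟩
  mkℚᵘ (+ (a ℕ.+ b)) 0              ≈⟨ *≡* (cong (ℤ._* + 1) +[a+b]≡a*1+b*1) ⟩
  mkℚᵘ (+ a) 0 ℚᵘ.+ mkℚᵘ (+ b) 0    ≈⟨ ℚᵘₚ.≃-sym (ℚᵘₚ.+-cong (toℚᵘ-/ a 0) (toℚᵘ-/ b 0)) ⟩
  toℚᵘ (toℚ a) ℚᵘ.+ toℚᵘ (toℚ b)    ≈⟨ ℚᵘₚ.≃-sym (ℚₚ.toℚᵘ-homo-+ (toℚ a) (toℚ b)) ⟩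
  toℚᵘ (toℚ a + toℚ b)              ∎)
  where
  open import Relation.Binary.Reasoning.Setoid ℚᵘₚ.≃-setoid
  +[a+b]≡a*1+b*1 : + (a ℕ.+ b) ≡ + a ℤ.* + 1 ℤ.+ + b ℤ.* + 1
  +[a+b]≡a*1+b*1 = trans (ℤₚ.pos-+ a b) (sym (cong₂ ℤ._+_ (ℤₚ.*-identityʳ (+ a)) (ℤₚ.*-identityʳ (+ b))))

toℚ-mono-≤ : ∀ {a b} → a ℕ.≤ b → toℚ a ≤ toℚ b
toℚ-mono-≤ {a} {b} a≤b = ℚₚ.toℚᵘ-cancel-≤
  (ℚᵘₚ.≤-respˡ-≃ (ℚᵘₚ.≃-sym (toℚᵘ-/ a 0)) (ℚᵘₚ.≤-respʳ-≃ (ℚᵘₚ.≃-sym (toℚᵘ-/ b 0))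
    (*≤* (ℤₚ.*-monoʳ-≤-nonNeg (+ 1) (ℤ.+≤+ a≤b)))))

floor-greatest : ∀ i r → mkℚᵘ i 0 ℚᵘ.≤ toℚᵘ r → i ℤ.≤ floor r
floor-greatest i (mkℚ a d _) (*≤* i*[1+d]≤a*1) =
  subst (i ℤ.≤_) (ℤₚ.pred-suc ⌊a/d⌋)
    (ℤₚ.i<j⇒i≤pred[j] {j = ℤ.suc ⌊a/d⌋} (ℤₚ.*-cancelʳ-<-nonNeg (+ suc d) i*[1+d]<[1+⌊a/d⌋]*[1+d]))
  where
  ⌊a/d⌋ : ℤ
  ⌊a/d⌋ = a ℤ./ + suc d
  i*[1+d]<[1+⌊a/d⌋]*[1+d] : i ℤ.* + suc d ℤ.< ℤ.suc ⌊a/d⌋ ℤ.* + suc d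
  i*[1+d]<[1+⌊a/d⌋]*[1+d] = ℤₚ.≤-<-trans (subst (i ℤ.* + suc d ℤ.≤_) (ℤₚ.*-identityʳ a) i*[1+d]≤a*1)
    (subst (λ t → a ℤ.< ℤ.suc t ℤ.* + suc d) (sym (ℤ.div-pos-is-/ℕ a (suc d))) (ℤ.n<s[n/ℕd]*d a (suc d)))

ceiling-least : ∀ q c → q ≤ toℚ c → ceiling q ℤ.≤ + c
ceiling-least q@record{} c q≤c =
  subst (ℤ.- floor (ℚ.- q) ℤ.≤_) (ℤₚ.neg-involutive (+ c))
    (ℤₚ.neg-mono-≤ (floor-greatest (ℤ.- + c) (ℚ.- q) -c≤-q))
  where
  -c≤-q : mkℚᵘ (ℤ.- + c) 0 ℚᵘ.≤ toℚᵘ (ℚ.- q)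
  -c≤-q = ℚᵘₚ.≤-respʳ-≃ (ℚᵘₚ.≃-sym (ℚₚ.toℚᵘ-homo‿- q))
            (ℚᵘₚ.neg-mono-≤ (ℚᵘₚ.≤-respʳ-≃ (toℚᵘ-/ c 0) (ℚₚ.toℚᵘ-mono-≤ q≤c)))

/-*-toℚ-≤ : ∀ k q y z → k ℕ.* y ℕ.≤ suc q ℕ.* z → ((+ k) / suc q) * toℚ y ≤ toℚ z
/-*-toℚ-≤ k q y z ky≤mz = ℚₚ.toℚᵘ-cancel-≤
  (ℚᵘₚ.≤-respˡ-≃ (ℚᵘₚ.≃-sym lhs) (ℚᵘₚ.≤-respʳ-≃ (ℚᵘₚ.≃-sym (toℚᵘ-/ z 0)) (*≤* cross)))
  where
  lhs : toℚᵘ (((+ k) / suc q) * toℚ y) ℚᵘ.≃ mkℚᵘ (+ k) q ℚᵘ.* mkℚᵘ (+ y) 0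
  lhs = ℚᵘₚ.≃-trans (ℚₚ.toℚᵘ-homo-* ((+ k) / suc q) (toℚ y)) (ℚᵘₚ.*-cong (toℚᵘ-/ k q) (toℚᵘ-/ y 0))
  cross : (+ k ℤ.* + y) ℤ.* + 1 ℤ.≤ + z ℤ.* + suc (q ℕ.* 1)
  cross = begin
    (+ k ℤ.* + y) ℤ.* + 1     ≡⟨ ℤₚ.*-identityʳ _ ⟩
    + k ℤ.* + y               ≡⟨ ℤₚ.pos-* k y ⟨
    + (k ℕ.* y)               ≤⟨ ℤ.+≤+ ky≤mz ⟩
    + (suc q ℕ.* z)           ≡⟨ cong +_ (ℕₚ.*-comm (suc q) z) ⟩
    + (z ℕ.* suc q)           ≡⟨ ℤₚ.pos-* z (suc q) ⟩
    + z ℤ.* + suc q           ≡⟨ cong (λ r → + z ℤ.* + suc r) (ℕₚ.*-identityʳ q) ⟨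
    + z ℤ.* + suc (q ℕ.* 1)   ∎
    where open ℤₚ.≤-Reasoning

κ≤1⇒κ[x+y]≤x+z : ∀ κ x y z → .{{NonNegative x}} → κ ≤ 1ℚ → κ * y ≤ z → κ * (x + y) ≤ x + z
κ≤1⇒κ[x+y]≤x+z κ x y z κ≤1 κy≤z = begin
  κ * (x + y)      ≡⟨ ℚₚ.*-distribˡ-+ κ x y ⟩
  κ * x + κ * y    ≤⟨ ℚₚ.+-mono-≤ (ℚₚ.*-monoʳ-≤-nonNeg x κ≤1) κy≤z ⟩
  1ℚ * x + z       ≡⟨ cong (_+ z) (ℚₚ.*-identityˡ x) ⟩
  x + z            ∎
  where open ℚₚ.≤-Reasoning

min-ratio-bound : ∀ k q x y z → k ℕ.* y ℕ.≤ suc q ℕ.* z →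
                  (((+ k) /ℕ suc q) ⊓ 1ℚ) * toℚ (x ℕ.+ y) ≤ toℚ (x ℕ.+ z)
min-ratio-bound k q x y z ky≤mz = begin
  κ * toℚ (x ℕ.+ y)       ≡⟨ cong (κ *_) (toℚ-+ x y) ⟩
  κ * (toℚ x + toℚ y)     ≤⟨ κ≤1⇒κ[x+y]≤x+z κ (toℚ x) (toℚ y) (toℚ z) {{toℚ-nonNeg x}} (ℚₚ.p⊓q≤q ((+ k) /ℕ suc q) 1ℚ) κy≤z ⟩
  toℚ x + toℚ z           ≡⟨ toℚ-+ x z ⟨
  toℚ (x ℕ.+ z)           ∎
  where
  open ℚₚ.≤-Reasoning
  κ : ℚ
  κ = ((+ k) /ℕ suc q) ⊓ 1ℚ
  κy≤z : κ * toℚ y ≤ toℚ z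
  κy≤z = ℚₚ.≤-trans (ℚₚ.*-monoʳ-≤-nonNeg (toℚ y) {{toℚ-nonNeg y}} (ℚₚ.p⊓q≤p ((+ k) /ℕ suc q) 1ℚ))
                    (/-*-toℚ-≤ k q y z ky≤mz)

negative-ratio-bound : ∀ k q a b → ((-[1+ k ] /ℕ suc q) ⊓ 1ℚ) * toℚ a ≤ toℚ b
negative-ratio-bound k q a b = begin
  κ * toℚ a     ≤⟨ ℚₚ.*-monoʳ-≤-nonNeg (toℚ a) {{toℚ-nonNeg a}} κ≤0 ⟩
  0ℚ * toℚ a    ≡⟨ ℚₚ.*-zeroˡ (toℚ a) ⟩
  0ℚ            ≤⟨ ℚₚ.nonNegative⁻¹ (toℚ b) {{toℚ-nonNeg b}} ⟩
  toℚ b         ∎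
  where
  open ℚₚ.≤-Reasoning
  κ : ℚ
  κ = (-[1+ k ] /ℕ suc q) ⊓ 1ℚ
  -- -[1+ k ] / d unfolds to - ((+ suc k) / d)
  κ≤0 : κ ≤ 0ℚ
  κ≤0 = ℚₚ.≤-trans (ℚₚ.p⊓q≤p (-[1+ k ] /ℕ suc q) 1ℚ)
          (ℚₚ.neg-antimono-≤ (ℚₚ.nonNegative⁻¹ ((+ suc k) / suc q) {{ℚₚ.normalize-nonNeg (suc k) (suc q)}}))

⌈αδ⌉≤∣N∩D∣ : ∀ {n} (G : Graph n) {α δ D} → 0ℚ ≤ α → (∀ v → δ ℕ.≤ deg G v) → IsAlphaDominating G α D →
             ∀ v → v ∉ D → ceiling (α * toℚ δ) ℤ.≤ + ∣ N G v ∩ D ∣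
⌈αδ⌉≤∣N∩D∣ G {α} {δ} {D} 0≤α δ≤deg D-dom v v∉D = ceiling-least (α * toℚ δ) ∣ N G v ∩ D ∣ (begin
  α * toℚ δ            ≤⟨ ℚₚ.*-monoˡ-≤-nonNeg α {{ℚ.nonNegative 0≤α}} (toℚ-mono-≤ (δ≤deg v)) ⟩
  α * toℚ (deg G v)    ≤⟨ D-dom v v∉D ⟩
  toℚ ∣ N G v ∩ D ∣    ∎)
  where open ℚₚ.≤-Reasoning

lemma3 : (p : ℕ) → p ≥ 2 → (α : ℚ) → 0ℚ < α → α < 1ℚ →
    {n : ℕ} (G : Graph n) → NoIsolated G → ClawFree p G →
    (δ : ℕ) → IsMinDegree G δ →
    (D : Subset n) → IsMinAlphaDominating G α D →
    (I : Subset n) → IsMaximalIndependent G I →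
    ((ceiling (α * toℚ δ) /ℕ (p ℕ.∸ 1)) ⊓ 1ℚ) * toℚ ∣ I ∣ ≤ toℚ ∣ D ∣
lemma3 (suc (suc q)) (ℕ.s≤s (ℕ.s≤s _)) α 0<α _ G _ claw-free δ (δ≤deg , _) D (D-dom , _) I (I-indep , _)
  with ceiling (α * toℚ δ) in ⌈αδ⌉≡c
-- ⌈αδ⌉ is never negative, but a negative coefficient makes the bound trivial anyway
... | -[1+ k ] = negative-ratio-bound k q ∣ I ∣ ∣ D ∣
... | + k = begin
  κ * toℚ ∣ I ∣                          ≡⟨ cong (λ s → κ * toℚ s) (∣p∣≡∣p∩q∣+∣p─q∣ I D) ⟩
  κ * toℚ (∣ I ∩ D ∣ ℕ.+ ∣ I ─ D ∣)      ≤⟨ min-ratio-bound k q (∣ I ∩ D ∣) (∣ I ─ D ∣) (∣ D ─ I ∣) k∣I─D∣≤[p-1]∣D─I∣ ⟩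
  toℚ (∣ I ∩ D ∣ ℕ.+ ∣ D ─ I ∣)          ≡⟨ cong (λ s → toℚ (∣ s ∣ ℕ.+ ∣ D ─ I ∣)) (∩-comm I D) ⟩
  toℚ (∣ D ∩ I ∣ ℕ.+ ∣ D ─ I ∣)          ≡⟨ cong toℚ (∣p∣≡∣p∩q∣+∣p─q∣ D I) ⟨
  toℚ ∣ D ∣                              ∎
  where
  open ℚₚ.≤-Reasoning
  κ : ℚ
  κ = ((+ k) /ℕ suc q) ⊓ 1ℚ
  k≤∣N∩D∣ : ∀ v → v ∉ D → k ℕ.≤ ∣ N G v ∩ D ∣
  k≤∣N∩D∣ v v∉D = ℤₚ.drop‿+≤+ (subst (ℤ._≤ _) ⌈αδ⌉≡c (⌈αδ⌉≤∣N∩D∣ G (ℚₚ.<⇒≤ 0<α) δ≤deg D-dom v v∉D))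
  k∣I─D∣≤[p-1]∣D─I∣ : k ℕ.* ∣ I ─ D ∣ ℕ.≤ suc q ℕ.* ∣ D ─ I ∣
  k∣I─D∣≤[p-1]∣D─I∣ = k*∣I─D∣≤m*∣D─I∣ G claw-free I D I-indep k≤∣N∩D∣
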